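{- Let $\mathbb{F} = (W,\nu)$ be a (monotone) n-frame. Then $\mathbb{F}^\star$ is a supported two-sorted n-frame.
   Context: An n-frame is a pair $(W,\nu)$ with $W$ a nonempty set and $\nu: W\to\mathcal{P}(\mathcal{P}(W))$ monotone: if $X\in\nu(w)$ and $X\subseteq Y\subseteq W$ then $Y\in\nu(w)$. Its associated two-sorted frame is $\mathbb{F}^\star = (W, \mathcal{P}(W), R_\ni, R_{\not\ni}, R_\nu, R_{\nu^c})$ where $R_\nu, R_{\nu^c}\subseteq W\times\mathcal{P}(W)$ and $R_\ni, R_{\not\ni}\subseteq\mathcal{P}(W)\times W$ are: $x R_\nu Z$ iff $Z\in\nu(x)$; $x R_{\nu^c} Z$ iff $Z\notin\nu(x)$; $Z R_\ni x$ iff $x\in Z$; $Z R_{\not\ni} x$ iff $x\notin Z$. A two-sorted n-frame is a tuple $(X, Y, R_\ni, R_{\not\ni}, R_\nu, R_{\nu^c})$ with $X,Y$ nonempty, $R_\ni,R_{\not\ni}\subseteq Y\times X$, $R_\nu,R_{\nu^c}\subseteq X\times Y$; writing $R^{ -1}[T'] = \{s\mid\exists t\in T'\,(sRt)\}$ and $(\cdot)^c$ for complement, it is supported if for every $D\subseteq X$: $R_\nu^{ -1}[(R_\ni^{ -1}[D^c])^c] = (R_{\nu^c}^{ -1}[(R_{\not\ni}^{ -1}[D])^c])^c$. -}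

module Defs where

open import Level using (Level; 0ℓ; _⊔_) renaming (suc to lsuc)
open import Data.Unit using (⊤)
open import Data.Product using (Σ; _×_; _,_)
open import Relation.Unary using (Pred; _∈_; _∉_; _⊆_; _≐_; ∁)

-- Conventions: a subset of a type A is a predicate  Pred A 0ℓ ; the power set
-- P(W) is the type  Pred W 0ℓ .  A binary relation R ⊆ S × T is  S → T → Set
-- (s R t  is  R s t).

record NFrame : Set₂ where
  field
    W        : Set
    w₀       : W
    ν        : W → Pred (Pred W 0ℓ) 0ℓ
    monotone : ∀ {w} {A B : Pred W 0ℓ} → A ∈ ν w → A ⊆ B → B ∈ ν w

record TwoSortedNFrame (a b : Level) : Set (lsuc (a ⊔ b)) where
  field
    X    : Set a
    Y    : Set b
    x₀   : X
    y₀   : Y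
    R∋   : Y → X → Set
    R∌   : Y → X → Set
    Rν   : X → Y → Set
    Rνᶜ  : X → Y → Set

preimage : ∀ {a b ℓ} {S : Set a} {T : Set b} →
           (S → T → Set) → Pred T ℓ → Pred S (b ⊔ ℓ)
preimage {T = T} R T' s = Σ T (λ t → t ∈ T' × R s t)

Supported : ∀ {a b} → TwoSortedNFrame a b → Set (lsuc 0ℓ ⊔ a ⊔ b)
Supported F = (D : Pred X 0ℓ) →
  preimage Rν (∁ (preimage R∋ (∁ D)))
    ≐ ∁ (preimage Rνᶜ (∁ (preimage R∌ D)))
  where open TwoSortedNFrame F

_★ : NFrame → TwoSortedNFrame 0ℓ (lsuc 0ℓ)
F ★ = record
  { X   = W
  ; Y   = Pred W 0ℓ
  ; x₀  = w₀
  ; y₀  = λ _ → ⊤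
  ; R∋  = λ Z x → x ∈ Z
  ; R∌  = λ Z x → x ∉ Z
  ; Rν  = λ x Z → Z ∈ ν x
  ; Rνᶜ = λ x Z → Z ∉ ν x
  }
  where open NFrame F

module Submission where

open import Defs
open import Level using (0ℓ)
open import Axiom.ExcludedMiddle using (ExcludedMiddle)
open import Axiom.DoubleNegationElimination using (DoubleNegationElimination; em⇒dne)
open import Data.Product using (_,_)
open import Relation.Nullary using (yes; no; contradiction)
open import Relation.Unary using (Pred; _∈_; _∉_; _⊆_; ∁)

-- Classically, (R∋⁻¹[Dᶜ])ᶜ is the down-set {Z | Z ⊆ D} and (R∌⁻¹[D])ᶜ the
-- up-set {Z | D ⊆ Z}.  By monotonicity of ν, no x has some Z ⊆ D in ν(x)
-- and some Z' ⊇ D outside it; and if x has no such Z', then D ∈ ν(x)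
-- witnesses the left-hand side.

module _ {W : Set} (D : Pred W 0ℓ) where

  NoPointOutside NoPointMissing : Pred (Pred W 0ℓ) _
  NoPointOutside = ∁ (preimage (λ Z x → x ∈ Z) (∁ D))
  NoPointMissing = ∁ (preimage (λ Z x → x ∉ Z) D)

  NoPointOutside⇒⊆ : DoubleNegationElimination 0ℓ →
                     ∀ {Z} → Z ∈ NoPointOutside → Z ⊆ D
  NoPointOutside⇒⊆ dne noOutside {z} z∈Z =
    dne λ z∉D → noOutside (z , z∉D , z∈Z)

  NoPointMissing⇒⊇ : DoubleNegationElimination 0ℓ →
                     ∀ {Z} → Z ∈ NoPointMissing → D ⊆ Z
  NoPointMissing⇒⊇ dne noMissing {z} z∈D =
    dne λ z∉Z → noMissing (z , z∈D , z∉Z)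

  self-NoPointOutside : D ∈ NoPointOutside
  self-NoPointOutside (_ , z∉D , z∈D) = z∉D z∈D

  self-NoPointMissing : D ∈ NoPointMissing
  self-NoPointMissing (_ , z∈D , z∉D) = z∉D z∈D

lemma4 : ExcludedMiddle 0ℓ → (F : NFrame) → Supported (F ★)
lemma4 em F D = down∈ν⇒no-up∉ν , no-up∉ν⇒down∈ν
  where
  open NFrame F
  dne : DoubleNegationElimination 0ℓ
  dne = em⇒dne em

  down∈ν⇒no-up∉ν : ∀ {x} → x ∈ preimage (λ x Z → Z ∈ ν x) (NoPointOutside D)
                          → x ∈ ∁ (preimage (λ x Z → Z ∉ ν x) (NoPointMissing D))
  down∈ν⇒no-up∉ν (Z , Z⊆D , Z∈ν) (Z′ , D⊆Z′ , Z′∉ν) =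
    Z′∉ν (monotone Z∈ν λ z∈Z →
      NoPointMissing⇒⊇ D dne D⊆Z′ (NoPointOutside⇒⊆ D dne Z⊆D z∈Z))

  no-up∉ν⇒down∈ν : ∀ {x} → x ∈ ∁ (preimage (λ x Z → Z ∉ ν x) (NoPointMissing D))
                          → x ∈ preimage (λ x Z → Z ∈ ν x) (NoPointOutside D)
  no-up∉ν⇒down∈ν {x} noUp with em {D ∈ ν x}
  ... | yes D∈ν = D , self-NoPointOutside D , D∈ν
  ... | no D∉ν  = contradiction (D , self-NoPointMissing D , D∉ν) noUp
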